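{- Let $t,u$ be vsub-terms and $d\colon t\to_{\mathsf{vsub}}^* u$. Then there exist a vsub$_k$-term $s$ and a derivation $e\colon \overline{t}\to_{\mathsf{vsub}_k}^* s$ such that: (1) $s\equiv\overline{u}$; (2) $|e|_{\mathtt m}=|d|_{\mathtt m}$, $|e|_{\mathtt e_\lambda}=|d|_{\mathtt e_\lambda}$ and $|e|_{\mathtt e_{\mathtt{var}}}=|d|_{\mathtt e_{\mathtt{var}}}+|d|_{\mathtt m}$; (3) if $u$ is $\mathsf{vsub}$-normal then $s$ is $\mathtt m$-normal and the $\mathtt e$-normal form of $s$ is $\mathsf{vsub}_k$-normal.
   Context: Value substitution calculus: vsub-terms $t,u,s::= v\mid tu\mid t[x\leftarrow u]$, vsub-values $v::=x\mid\lambda x.t$; $t[x\leftarrow u]$ binds $x$ in $t$; terms up to $\alpha$; $t\{x\leftarrow u\}$ capture-avoiding substitution. Evaluation contexts $E::=\langle\cdot\rangle\mid tE\mid Et\mid E[x\leftarrow u]\mid t[x\leftarrow E]$; substitution contexts $L::=\langle\cdot\rangle\mid L[x\leftarrow u]$. Root rules: $L\langle\lambda x.t\rangle u\mapsto_{\mathtt m} L\langle t[x\leftarrow u]\rangle$; $t[x\leftarrow L\langle \lambda y.u\rangle]\mapsto_{\mathtt e_\lambda} L\langle t\{x\leftarrow\lambda y.u\}\rangle$; $t[x\leftarrow L\langle y\rangle]\mapsto_{\mathtt e_{\mathtt{var}}} L\langle t\{x\leftarrow y\}\rangle$ (variables bound by $L$ not free in $u$, resp. $t$). Their closures under evaluation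 contexts give $\to_{\mathtt m},\to_{\mathtt e_\lambda},\to_{\mathtt e_{\mathtt{var}}}$; $\to_{\mathtt e}=\to_{\mathtt e_\lambda}\cup\to_{\mathtt e_{\mathtt{var}}}$; $\to_{\mathsf{vsub}}=\to_{\mathtt m}\cup\to_{\mathtt e}$. $\to_{\mathtt e}$ is terminating and confluent, so each term has a unique $\mathtt e$-normal form. Kernel: vsub$_k$-terms are the vsub-terms generated by $t,u::= v\mid tv\mid t[x\leftarrow u]$, $v::=x\mid\lambda x.t$ (right arguments of applications are values). This set is closed under $\to_{\mathsf{vsub}}$, and $\to_{\mathsf{vsub}_k}$ (with its $\mathtt m$, $\mathtt e_\lambda$, $\mathtt e_{\mathtt{var}}$ steps) is the restriction of $\to_{\mathsf{vsub}}$ to vsub$_k$-terms. Translation: $\overline{x}=x$; $\overline{tu}=(\overline{t}\,x)[x\leftarrow\overline{u}]$ with $x$ fresh; $\overline{\lambda x.t}=\lambda x.\overline{t}$; $\overline{t[x\leftarrow u]}=\overline{t}[x\leftarrow\overline{u}]$. Structural equivalence $\equiv$: least equivalence on vsub-terms closed under evaluation contexts containing $t[y\leftarrow s][x\leftarrow u]\equiv t[x\leftarrow u][y\leftarrow s]$ ($y\notin\mathrm{fv}(u)$, $x\notin\mathrm{fv}(s)$); $t\,(s[x\leftarrow u])\equiv (ts)[x\leftarrow u]$ ($x\notin\mathrm{fv}(t)$); $t[x\leftarrow u]\,s\equiv (ts)[x\leftarrow u]$ ($x\notin\mathrm{fv}(s)$); $t[x\leftarrow u[y\leftarrow s]]\equiv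 t[x\leftarrow u][y\leftarrow s]$ ($y\notin\mathrm{fv}(t)$). $|d|_{\mathsf r}$ denotes the number of $\mathsf r$-steps in a derivation $d$. -}

module Defs where

open import Data.Nat using (ℕ; zero; suc; _+_)
open import Data.Fin using (Fin; zero; suc)
open import Data.Empty using (⊥)
open import Data.Unit using (⊤)
open import Data.Product using (_×_)
open import Relation.Nullary using (¬_)

-- Well-scoped de Bruijn vsub-terms (terms up to α-equivalence).
-- es t u  represents  t[x←u]  (x is index 0 in t).
data Tm (n : ℕ) : Set where
  var : Fin n → Tm n
  lam : Tm (suc n) → Tm n
  app : Tm n → Tm n → Tm n
  es  : Tm (suc n) → Tm n → Tm n

ext : ∀ {n m} → (Fin n → Fin m) → Fin (suc n) → Fin (suc m)
ext ρ zero = zero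
ext ρ (suc i) = suc (ρ i)

ren : ∀ {n m} → (Fin n → Fin m) → Tm n → Tm m
ren ρ (var i) = var (ρ i)
ren ρ (lam t) = lam (ren (ext ρ) t)
ren ρ (app t u) = app (ren ρ t) (ren ρ u)
ren ρ (es t u) = es (ren (ext ρ) t) (ren ρ u)

wk : ∀ {n} → Tm n → Tm (suc n)
wk = ren suc

exts : ∀ {n m} → (Fin n → Tm m) → Fin (suc n) → Tm (suc m)
exts σ zero = var zero
exts σ (suc i) = wk (σ i)

sub : ∀ {n m} → (Fin n → Tm m) → Tm n → Tm m
sub σ (var i) = σ i
sub σ (lam t) = lam (sub (exts σ) t)
sub σ (app t u) = app (sub σ t) (sub σ u)
sub σ (es t u) = es (sub (exts σ) t) (sub σ u)

-- t{x←u}, x = index 0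
subst0 : ∀ {n} → Tm (suc n) → Tm n → Tm n
subst0 {n} t u = sub σ t
  where
  σ : Fin (suc n) → Tm n
  σ zero = u
  σ (suc i) = var i

swap01 : ∀ {n} → Fin (suc (suc n)) → Fin (suc (suc n))
swap01 zero = suc zero
swap01 (suc zero) = zero
swap01 (suc (suc i)) = suc (suc i)

-- Substitution contexts L ::= ⟨·⟩ | L[x←u];  SCtx n m : hole of scope m, result of scope n
data SCtx : ℕ → ℕ → Set where
  hole : ∀ {n} → SCtx n n
  _[←_] : ∀ {n m} → SCtx (suc n) m → Tm n → SCtx n m

plug : ∀ {n m} → SCtx n m → Tm m → Tm n
plug hole t = t
plug (L [← u ]) t = es (plug L t) u

-- renaming moving a term under the binders of L (they are thus not free in it)
under : ∀ {n m} → SCtx n m → Fin n → Fin m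
under hole i = i
under (L [← u ]) i = under L (suc i)

data Kind : Set where
  m eλ evar : Kind

data Root {n : ℕ} : Kind → Tm n → Tm n → Set where
  rm : ∀ {k} (L : SCtx n k) (t : Tm (suc k)) (u : Tm n) →
       Root m (app (plug L (lam t)) u) (plug L (es t (ren (under L) u)))
  reλ : ∀ {k} (t : Tm (suc n)) (L : SCtx n k) (u : Tm (suc k)) →
       Root eλ (es t (plug L (lam u))) (plug L (subst0 (ren (ext (under L)) t) (lam u)))
  revar : ∀ {k} (t : Tm (suc n)) (L : SCtx n k) (y : Fin k) →
       Root evar (es t (plug L (var y))) (plug L (subst0 (ren (ext (under L)) t) (var y)))

data Step : {n : ℕ} → Kind → Tm n → Tm n → Set where
  root : ∀ {n k} {t u : Tm n} → Root k t u → Step k t u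
  appL : ∀ {n k} {t t' u : Tm n} → Step k t t' → Step k (app t u) (app t' u)
  appR : ∀ {n k} {t u u' : Tm n} → Step k u u' → Step k (app t u) (app t u')
  esL  : ∀ {n k} {t t' : Tm (suc n)} {u : Tm n} → Step k t t' → Step k (es t u) (es t' u)
  esR  : ∀ {n k} {t : Tm (suc n)} {u u' : Tm n} → Step k u u' → Step k (es t u) (es t u')

data IsValueK {n : ℕ} : Tm n → Set
data IsKernel : {n : ℕ} → Tm n → Set

data IsValueK {n} where
  kvar : (i : Fin n) → IsValueK (var i)
  klam : {t : Tm (suc n)} → IsKernel t → IsValueK (lam t)

data IsKernel where
  kval : ∀ {n} {v : Tm n} → IsValueK v → IsKernel v
  kapp : ∀ {n} {t v : Tm n} → IsKernel t → IsValueK v → IsKernel (app t v)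
  kes  : ∀ {n} {t : Tm (suc n)} {u : Tm n} → IsKernel t → IsKernel u → IsKernel (es t u)

StepK : ∀ {n} → Kind → Tm n → Tm n → Set
StepK k t u = IsKernel t × IsKernel u × Step k t u

IsE : Kind → Set
IsE m = ⊥
IsE eλ = ⊤
IsE evar = ⊤

StepE : ∀ {n} → Kind → Tm n → Tm n → Set
StepE k t u = IsE k × Step k t u

data Deriv {n : ℕ} (R : Kind → Tm n → Tm n → Set) : Tm n → Tm n → Set where
  ε   : ∀ {t} → Deriv R t t
  _◅_ : ∀ {k t t' u} → R k t t' → Deriv R t' u → Deriv R t u

sameK : Kind → Kind → ℕ
sameK m m = 1
sameK eλ eλ = 1
sameK evar evar = 1
sameK _ _ = 0

count : ∀ {n} {R : Kind → Tm n → Tm n → Set} {t u : Tm n} → Kind → Deriv R t u → ℕ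
count k ε = 0
count k (_◅_ {k'} _ d) = sameK k k' + count k d

VsubNormal : ∀ {n} → Tm n → Set
VsubNormal t = ∀ k t' → ¬ Step k t t'

MNormal : ∀ {n} → Tm n → Set
MNormal t = ∀ t' → ¬ Step m t t'

ENormal : ∀ {n} → Tm n → Set
ENormal t = ∀ k t' → ¬ StepE k t t'

VsubKNormal : ∀ {n} → Tm n → Set
VsubKNormal t = ∀ k t' → ¬ StepK k t t'

tr : ∀ {n} → Tm n → Tm n
tr (var i) = var i
tr (app t u) = es (app (wk (tr t)) (var zero)) (tr u)
tr (lam t) = lam (tr t)
tr (es t u) = es (tr t) (tr u)

infix 4 _≡s_
data _≡s_ : {n : ℕ} → Tm n → Tm n → Set where
  ≡refl  : ∀ {n} {t : Tm n} → t ≡s t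
  ≡sym   : ∀ {n} {t u : Tm n} → t ≡s u → u ≡s t
  ≡trans : ∀ {n} {t u s : Tm n} → t ≡s u → u ≡s s → t ≡s s
  ≡appL  : ∀ {n} {t t' u : Tm n} → t ≡s t' → app t u ≡s app t' u
  ≡appR  : ∀ {n} {t u u' : Tm n} → u ≡s u' → app t u ≡s app t u'
  ≡esL   : ∀ {n} {t t' : Tm (suc n)} {u : Tm n} → t ≡s t' → es t u ≡s es t' u
  ≡esR   : ∀ {n} {t : Tm (suc n)} {u u' : Tm n} → u ≡s u' → es t u ≡s es t u'
  -- t[y←s][x←u] ≡ t[x←u][y←s]   (y∉fv(u), x∉fv(s))
  ≡com   : ∀ {n} (t : Tm (suc (suc n))) (s u : Tm n) →
           es (es t (wk s)) u ≡s es (es (ren swap01 t) (wk u)) s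
  -- t (s[x←u]) ≡ (t s)[x←u]   (x∉fv(t))
  ≡appr    : ∀ {n} (t : Tm n) (s : Tm (suc n)) (u : Tm n) →
           app t (es s u) ≡s es (app (wk t) s) u
  -- t[x←u] s ≡ (t s)[x←u]   (x∉fv(s))
  ≡appl    : ∀ {n} (t : Tm (suc n)) (u s : Tm n) →
           app (es t u) s ≡s es (app t (wk s)) u
  -- t[x←u[y←s]] ≡ t[x←u][y←s]   (y∉fv(t))
  ≡[·]   : ∀ {n} (t : Tm (suc n)) (u : Tm (suc n)) (s : Tm n) →
           es t (es u s) ≡s es (es (ren (ext suc) t) u) s

-- A translated application (t u)‾ = (t̄ x)[x←ū] performs the m-step of t u and then one
-- administrative e_var-step replacing x; the result is the translated contractum up to
-- commuting explicit substitutions, while e-steps are simulated by a single step of the same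
-- kind.  The commutation rule of ≡ alone suffices, and its closure is a strong bisimulation
-- for →vsub, so the simulation extends to derivations, counting one extra e_var-step per
-- m-step.  When u is normal, every e-reduct of ū is ū with some administrative redexes fired;
-- such terms have no m-redex, and through the bisimulation neither do the final term and its
-- e-normal forms, which are therefore vsub_k-normal.

module Submission where

open import Defs
open import Data.Nat using (ℕ; _+_; suc; zero)
open import Data.Nat.Properties using (+-assoc; +-identityʳ; +-commutativeSemigroup)
open import Algebra.Properties.CommutativeSemigroup +-commutativeSemigroup using (interchange)
open import Data.Fin using (Fin; zero; suc)
open import Data.Vec.Functional using (_∷_)
open import Data.Product using (Σ; _×_; _,_; proj₁; proj₂)
open import Data.Sum using (_⊎_; inj₁; inj₂)
open import Data.Empty using (⊥-elim)
open import Data.Unit using (tt)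
open import Relation.Nullary using (¬_)
open import Relation.Binary.PropositionalEquality
  using (_≡_; refl; sym; trans; cong; cong₂; subst; subst₂; _≗_; _≢_; module ≡-Reasoning)
import Relation.Binary.Construct.Closure.ReflexiveTransitive as Star
open Star using (Star; ε; _◅_; gmap; reverse; return)
open import Function using (_∘_; id)

-- Renaming and substitution

ext-cong : ∀ {n m} {ρ ρ' : Fin n → Fin m} → ρ ≗ ρ' → ext ρ ≗ ext ρ'
ext-cong e zero = refl
ext-cong e (suc i) = cong suc (e i)

ren-cong : ∀ {n m} {ρ ρ' : Fin n → Fin m} → ρ ≗ ρ' → ren ρ ≗ ren ρ'
ren-cong e (var i) = cong var (e i)
ren-cong e (lam t) = cong lam (ren-cong (ext-cong e) t)
ren-cong e (app t u) = cong₂ app (ren-cong e t) (ren-cong e u)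
ren-cong e (es t u) = cong₂ es (ren-cong (ext-cong e) t) (ren-cong e u)

ext-∘ : ∀ {n m k} (ρ : Fin m → Fin k) (σ : Fin n → Fin m) → ext ρ ∘ ext σ ≗ ext (ρ ∘ σ)
ext-∘ ρ σ zero = refl
ext-∘ ρ σ (suc i) = refl

ren-ren : ∀ {n m k} (ρ : Fin m → Fin k) (σ : Fin n → Fin m) t → ren ρ (ren σ t) ≡ ren (ρ ∘ σ) t
ren-ren ρ σ (var i) = refl
ren-ren ρ σ (lam t) = cong lam (trans (ren-ren (ext ρ) (ext σ) t) (ren-cong (ext-∘ ρ σ) t))
ren-ren ρ σ (app t u) = cong₂ app (ren-ren ρ σ t) (ren-ren ρ σ u)
ren-ren ρ σ (es t u) = cong₂ es (trans (ren-ren (ext ρ) (ext σ) t) (ren-cong (ext-∘ ρ σ) t)) (ren-ren ρ σ u)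

ext-id : ∀ {n} {ρ : Fin n → Fin n} → ρ ≗ id → ext ρ ≗ id
ext-id e zero = refl
ext-id e (suc i) = cong suc (e i)

ren-≗id : ∀ {n} {ρ : Fin n → Fin n} → ρ ≗ id → ren ρ ≗ id
ren-≗id e (var i) = cong var (e i)
ren-≗id e (lam t) = cong lam (ren-≗id (ext-id e) t)
ren-≗id e (app t u) = cong₂ app (ren-≗id e t) (ren-≗id e u)
ren-≗id e (es t u) = cong₂ es (ren-≗id (ext-id e) t) (ren-≗id e u)

ren-id : ∀ {n} → ren {n} id ≗ id
ren-id = ren-≗id (λ _ → refl)

exts-cong : ∀ {n m} {σ σ' : Fin n → Tm m} → σ ≗ σ' → exts σ ≗ exts σ'
exts-cong e zero = refl
exts-cong e (suc i) = cong wk (e i)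

sub-cong : ∀ {n m} {σ σ' : Fin n → Tm m} → σ ≗ σ' → sub σ ≗ sub σ'
sub-cong e (var i) = e i
sub-cong e (lam t) = cong lam (sub-cong (exts-cong e) t)
sub-cong e (app t u) = cong₂ app (sub-cong e t) (sub-cong e u)
sub-cong e (es t u) = cong₂ es (sub-cong (exts-cong e) t) (sub-cong e u)

exts-ext : ∀ {n m k} (σ : Fin m → Tm k) (ρ : Fin n → Fin m) → exts σ ∘ ext ρ ≗ exts (σ ∘ ρ)
exts-ext σ ρ zero = refl
exts-ext σ ρ (suc i) = refl

sub-ren : ∀ {n m k} (σ : Fin m → Tm k) (ρ : Fin n → Fin m) t → sub σ (ren ρ t) ≡ sub (σ ∘ ρ) t
sub-ren σ ρ (var i) = refl
sub-ren σ ρ (lam t) = cong lam (trans (sub-ren (exts σ) (ext ρ) t) (sub-cong (exts-ext σ ρ) t))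
sub-ren σ ρ (app t u) = cong₂ app (sub-ren σ ρ t) (sub-ren σ ρ u)
sub-ren σ ρ (es t u) = cong₂ es (trans (sub-ren (exts σ) (ext ρ) t) (sub-cong (exts-ext σ ρ) t)) (sub-ren σ ρ u)

ext-exts : ∀ {n m k} (ρ : Fin m → Fin k) (σ : Fin n → Tm m) → ren (ext ρ) ∘ exts σ ≗ exts (ren ρ ∘ σ)
ext-exts ρ σ zero = refl
ext-exts ρ σ (suc i) = trans (ren-ren (ext ρ) suc (σ i)) (sym (ren-ren suc ρ (σ i)))

ren-sub : ∀ {n m k} (ρ : Fin m → Fin k) (σ : Fin n → Tm m) t → ren ρ (sub σ t) ≡ sub (ren ρ ∘ σ) t
ren-sub ρ σ (var i) = refl
ren-sub ρ σ (lam t) = cong lam (trans (ren-sub (ext ρ) (exts σ) t) (sub-cong (ext-exts ρ σ) t))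
ren-sub ρ σ (app t u) = cong₂ app (ren-sub ρ σ t) (ren-sub ρ σ u)
ren-sub ρ σ (es t u) = cong₂ es (trans (ren-sub (ext ρ) (exts σ) t) (sub-cong (ext-exts ρ σ) t)) (ren-sub ρ σ u)

exts-var : ∀ {n m} (ρ : Fin n → Fin m) → exts (var ∘ ρ) ≗ var ∘ ext ρ
exts-var ρ zero = refl
exts-var ρ (suc i) = refl

ren≡sub : ∀ {n m} (ρ : Fin n → Fin m) t → ren ρ t ≡ sub (var ∘ ρ) t
ren≡sub ρ (var i) = refl
ren≡sub ρ (lam t) = cong lam (trans (ren≡sub (ext ρ) t) (sym (sub-cong (exts-var ρ) t)))
ren≡sub ρ (app t u) = cong₂ app (ren≡sub ρ t) (ren≡sub ρ u)
ren≡sub ρ (es t u) = cong₂ es (trans (ren≡sub (ext ρ) t) (sym (sub-cong (exts-var ρ) t))) (ren≡sub ρ u)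

wk-ren : ∀ {n m} (ρ : Fin n → Fin m) t → wk (ren ρ t) ≡ ren (ext ρ) (wk t)
wk-ren ρ t = trans (ren-ren suc ρ t) (sym (ren-ren (ext ρ) suc t))

wk-sub : ∀ {n m} (σ : Fin n → Tm m) t → wk (sub σ t) ≡ sub (exts σ) (wk t)
wk-sub σ t = trans (ren-sub suc σ t) (sym (sub-ren (exts σ) suc t))

single : ∀ {n} → Tm n → Fin (suc n) → Tm n
single u = u ∷ var

subst0≡sub : ∀ {n} (t : Tm (suc n)) u → subst0 t u ≡ sub (single u) t
subst0≡sub t u = sub-cong (λ { zero → refl ; (suc i) → refl }) t

ren-subst0 : ∀ {n m} (ρ : Fin n → Fin m) (t : Tm (suc n)) u →
  ren ρ (subst0 t u) ≡ subst0 (ren (ext ρ) t) (ren ρ u)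
ren-subst0 ρ t u = begin
  ren ρ (subst0 t u)                   ≡⟨ cong (ren ρ) (subst0≡sub t u) ⟩
  ren ρ (sub (single u) t)             ≡⟨ ren-sub ρ (single u) t ⟩
  sub (ren ρ ∘ single u) t             ≡⟨ sub-cong (λ { zero → refl ; (suc i) → refl }) t ⟩
  sub (single (ren ρ u) ∘ ext ρ) t     ≡⟨ sym (sub-ren (single (ren ρ u)) (ext ρ) t) ⟩
  sub (single (ren ρ u)) (ren (ext ρ) t) ≡⟨ sym (subst0≡sub (ren (ext ρ) t) (ren ρ u)) ⟩
  subst0 (ren (ext ρ) t) (ren ρ u)     ∎
  where open ≡-Reasoning

sub-single-wk : ∀ {n m} (ρ : Fin n → Fin m) (u : Tm n) (h : Tm m) → sub (single h) (ren (ext ρ) (wk u)) ≡ ren ρ u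
sub-single-wk ρ u h = begin
  sub (single h) (ren (ext ρ) (wk u)) ≡⟨ cong (sub (single h)) (ren-ren (ext ρ) suc u) ⟩
  sub (single h) (ren (suc ∘ ρ) u)    ≡⟨ sub-ren (single h) (suc ∘ ρ) u ⟩
  sub (var ∘ ρ) u                     ≡⟨ sym (ren≡sub ρ u) ⟩
  ren ρ u                             ∎
  where open ≡-Reasoning

-- The translation

tr-ren : ∀ {n m} (ρ : Fin n → Fin m) t → tr (ren ρ t) ≡ ren ρ (tr t)
tr-ren ρ (var i) = refl
tr-ren ρ (lam t) = cong lam (tr-ren (ext ρ) t)
tr-ren ρ (app t u) =
  cong₂ es (cong (λ z → app z (var zero)) (trans (cong wk (tr-ren ρ t)) (wk-ren ρ (tr t)))) (tr-ren ρ u)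
tr-ren ρ (es t u) = cong₂ es (tr-ren (ext ρ) t) (tr-ren ρ u)

tr-exts : ∀ {n m} (σ : Fin n → Tm m) → tr ∘ exts σ ≗ exts (tr ∘ σ)
tr-exts σ zero = refl
tr-exts σ (suc i) = tr-ren suc (σ i)

tr-sub : ∀ {n m} (σ : Fin n → Tm m) t → tr (sub σ t) ≡ sub (tr ∘ σ) (tr t)
tr-sub σ (var i) = refl
tr-sub σ (lam t) = cong lam (trans (tr-sub (exts σ) t) (sub-cong (tr-exts σ) (tr t)))
tr-sub σ (app t u) =
  cong₂ es (cong (λ z → app z (var zero)) (trans (cong wk (tr-sub σ t)) (wk-sub (tr ∘ σ) (tr t)))) (tr-sub σ u)
tr-sub σ (es t u) = cong₂ es (trans (tr-sub (exts σ) t) (sub-cong (tr-exts σ) (tr t))) (tr-sub σ u)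

tr-subst0 : ∀ {n} (t : Tm (suc n)) u → tr (subst0 t u) ≡ subst0 (tr t) (tr u)
tr-subst0 t u = begin
  tr (subst0 t u)               ≡⟨ cong tr (subst0≡sub t u) ⟩
  tr (sub (single u) t)         ≡⟨ tr-sub (single u) t ⟩
  sub (tr ∘ single u) (tr t)    ≡⟨ sub-cong (λ { zero → refl ; (suc i) → refl }) (tr t) ⟩
  sub (single (tr u)) (tr t)    ≡⟨ sym (subst0≡sub (tr t) (tr u)) ⟩
  subst0 (tr t) (tr u)          ∎
  where open ≡-Reasoning

trCtx : ∀ {n k} → SCtx n k → SCtx n k
trCtx hole = hole
trCtx (L [← u ]) = trCtx L [← tr u ]

tr-plug : ∀ {n k} (L : SCtx n k) t → tr (plug L t) ≡ plug (trCtx L) (tr t)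
tr-plug hole t = refl
tr-plug (L [← u ]) t = cong (λ z → es z (tr u)) (tr-plug L t)

under-trCtx : ∀ {n k} (L : SCtx n k) → under (trCtx L) ≗ under L
under-trCtx hole i = refl
under-trCtx (L [← u ]) i = under-trCtx L (suc i)

eContractum : ∀ {n j} → Tm (suc n) → SCtx n j → Tm j → Tm n
eContractum t L h = plug L (subst0 (ren (ext (under L)) t) h)

mContractum : ∀ {n j} → SCtx n j → Tm (suc j) → Tm n → Tm n
mContractum L t u = plug L (es t (ren (under L) u))

data Val {n} : Kind → Tm n → Set where
  var : (i : Fin n) → Val evar (var i)
  lam : (t : Tm (suc n)) → Val eλ (lam t)

e-root : ∀ {n j k} {h : Tm j} → Val k h → (t : Tm (suc n)) (L : SCtx n j) →
  Step k (es t (plug L h)) (eContractum t L h)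
e-root (var i) t L = root (revar t L i)
e-root (lam u) t L = root (reλ t L u)

ren-val : ∀ {n m k} (ρ : Fin n → Fin m) {h} → Val k h → Val k (ren ρ h)
ren-val ρ (var i) = var (ρ i)
ren-val ρ (lam t) = lam (ren (ext ρ) t)

ren-val⁻¹ : ∀ {n m k} {ρ : Fin n → Fin m} h → Val k (ren ρ h) → Val k h
ren-val⁻¹ (var i) (var _) = var i
ren-val⁻¹ (lam t) (lam _) = lam t

tr-val : ∀ {n k} {h : Tm n} → Val k h → Val k (tr h)
tr-val (var i) = var i
tr-val (lam t) = lam (tr t)

tr-eContractum : ∀ {n j} (t : Tm (suc n)) (L : SCtx n j) h →
  tr (eContractum t L h) ≡ eContractum (tr t) (trCtx L) (tr h)
tr-eContractum t L h = trans (tr-plug L _) (cong (plug (trCtx L)) (trans (tr-subst0 (ren (ext (under L)) t) h)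
  (cong (λ z → subst0 z (tr h)) (trans (tr-ren (ext (under L)) t) (ren-cong (ext-cong (sym ∘ under-trCtx L)) (tr t))))))

tr-mContractum : ∀ {n j} (L : SCtx n j) t u → tr (mContractum L t u) ≡ mContractum (trCtx L) (tr t) (tr u)
tr-mContractum L t u = trans (tr-plug L _)
  (cong (λ z → plug (trCtx L) (es (tr t) z)) (trans (tr-ren (under L) u) (ren-cong (sym ∘ under-trCtx L) (tr u))))

-- RenCtx ρ L L' σ: L' is L renamed by ρ, and σ is the induced renaming of the hole scope.
-- Renamings are related up to ≗ so that composites can be compared.
data RenCtx : ∀ {n n' k k'} → (Fin n → Fin n') → SCtx n k → SCtx n' k' → (Fin k → Fin k') → Set where
  hole : ∀ {n n'} {ρ σ : Fin n → Fin n'} → σ ≗ ρ → RenCtx ρ hole hole σ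
  bind : ∀ {n n' k k'} {ρ : Fin n → Fin n'} {ρ' : Fin (suc n) → Fin (suc n')}
            {L : SCtx (suc n) k} {L' : SCtx (suc n') k'} {σ : Fin k → Fin k'} {u : Tm n} {u' : Tm n'} →
          RenCtx ρ' L L' σ → ρ' ≗ ext ρ → u' ≡ ren ρ u → RenCtx ρ (L [← u ]) (L' [← u' ]) σ

record RenamedCtx {n n' k} (ρ : Fin n → Fin n') (L : SCtx n k) : Set where
  constructor renamed
  field
    {k'} : ℕ
    L' : SCtx n' k'
    σ : Fin k → Fin k'
    isRen : RenCtx ρ L L' σ

renCtx : ∀ {n n' k} (ρ : Fin n → Fin n') (L : SCtx n k) → RenamedCtx ρ L
renCtx ρ hole = renamed hole ρ (hole (λ _ → refl))
renCtx ρ (L [← u ]) with renCtx (ext ρ) L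
... | renamed L' σ r = renamed (L' [← ren ρ u ]) σ (bind r (λ _ → refl) refl)

ren-plug : ∀ {n n' k k'} {ρ : Fin n → Fin n'} {L : SCtx n k} {L' : SCtx n' k'} {σ} →
  RenCtx ρ L L' σ → ∀ t → ren ρ (plug L t) ≡ plug L' (ren σ t)
ren-plug (hole e) t = ren-cong (sym ∘ e) t
ren-plug (bind {L = L} r e q) t = cong₂ es (trans (ren-cong (sym ∘ e) (plug L t)) (ren-plug r t)) (sym q)

under-ren : ∀ {n n' k k'} {ρ : Fin n → Fin n'} {L : SCtx n k} {L' : SCtx n' k'} {σ} →
  RenCtx ρ L L' σ → under L' ∘ ρ ≗ σ ∘ under L
under-ren (hole e) i = sym (e i)
under-ren (bind {L' = L'} r e q) i = trans (cong (under L') (sym (e (suc i)))) (under-ren r (suc i))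

module _ {n n' k k'} {ρ : Fin n → Fin n'} {L : SCtx n k} {L' : SCtx n' k'} {σ : Fin k → Fin k'} where

  ren-under : RenCtx ρ L L' σ → ∀ u → ren (under L') (ren ρ u) ≡ ren σ (ren (under L) u)
  ren-under r u = trans (ren-ren (under L') ρ u) (trans (ren-cong (under-ren r) u) (sym (ren-ren σ (under L) u)))

  ren-ext-under : RenCtx ρ L L' σ → ∀ t → ren (ext (under L')) (ren (ext ρ) t) ≡ ren (ext σ) (ren (ext (under L)) t)
  ren-ext-under r t = begin
    ren (ext (under L')) (ren (ext ρ) t)   ≡⟨ ren-ren (ext (under L')) (ext ρ) t ⟩
    ren (ext (under L') ∘ ext ρ) t         ≡⟨ ren-cong (λ i → trans (ext-∘ (under L') ρ i)
                                                (trans (ext-cong (under-ren r) i) (sym (ext-∘ σ (under L) i)))) t ⟩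
    ren (ext σ ∘ ext (under L)) t          ≡⟨ sym (ren-ren (ext σ) (ext (under L)) t) ⟩
    ren (ext σ) (ren (ext (under L)) t)    ∎
    where open ≡-Reasoning

  ren-eContractum : RenCtx ρ L L' σ → ∀ t h → ren ρ (eContractum t L h) ≡ eContractum (ren (ext ρ) t) L' (ren σ h)
  ren-eContractum r t h = begin
    ren ρ (plug L (subst0 (ren (ext (under L)) t) h))          ≡⟨ ren-plug r _ ⟩
    plug L' (ren σ (subst0 (ren (ext (under L)) t) h))         ≡⟨ cong (plug L') (ren-subst0 σ (ren (ext (under L)) t) h) ⟩
    plug L' (subst0 (ren (ext σ) (ren (ext (under L)) t)) (ren σ h))
                         ≡⟨ cong (λ z → plug L' (subst0 z (ren σ h))) (sym (ren-ext-under r t)) ⟩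
    plug L' (subst0 (ren (ext (under L')) (ren (ext ρ) t)) (ren σ h)) ∎
    where open ≡-Reasoning

  ren-mContractum : RenCtx ρ L L' σ → ∀ t u → ren ρ (mContractum L t u) ≡ mContractum L' (ren (ext σ) t) (ren ρ u)
  ren-mContractum r t u = trans (ren-plug r _) (cong (λ z → plug L' (es (ren (ext σ) t) z)) (sym (ren-under r u)))

renCtx-cong : ∀ {n n' k k'} {ρ ρ' : Fin n → Fin n'} {L : SCtx n k} {L' : SCtx n' k'} {σ} →
  RenCtx ρ L L' σ → ρ ≗ ρ' → RenCtx ρ' L L' σ
renCtx-cong (hole e) f = hole (λ i → trans (e i) (f i))
renCtx-cong (bind {u = u} r e q) f = bind r (λ i → trans (e i) (ext-cong f i)) (trans q (ren-cong f u))

renCtx-∘ : ∀ {n₁ n₂ n₃ k₁ k₂ k₃} {ρ₁ : Fin n₁ → Fin n₂} {ρ₂ : Fin n₂ → Fin n₃}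
  {L₁ : SCtx n₁ k₁} {L₂ : SCtx n₂ k₂} {L₃ : SCtx n₃ k₃} {σ₁ σ₂} →
  RenCtx ρ₂ L₂ L₃ σ₂ → RenCtx ρ₁ L₁ L₂ σ₁ → RenCtx (ρ₂ ∘ ρ₁) L₁ L₃ (σ₂ ∘ σ₁)
renCtx-∘ {ρ₂ = ρ₂} (hole e₂) (hole {σ = σ₁} e₁) = hole (λ i → trans (e₂ (σ₁ i)) (cong ρ₂ (e₁ i)))
renCtx-∘ {ρ₁ = ρ₁} {ρ₂} (bind r₂ e₂ q₂) (bind {ρ' = ρ₁'} {u = u} r₁ e₁ q₁) =
  bind (renCtx-∘ r₂ r₁) (λ i → trans (e₂ (ρ₁' i)) (trans (cong (ext ρ₂) (e₁ i)) (ext-∘ ρ₂ ρ₁ i)))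
    (trans q₂ (trans (cong (ren ρ₂) q₁) (ren-ren ρ₂ ρ₁ u)))

es-injective : ∀ {n} {a a' : Tm (suc n)} {b b'} → es a b ≡ es a' b' → a ≡ a' × b ≡ b'
es-injective refl = refl , refl

app-injective : ∀ {n} {a a' b b' : Tm n} → app a b ≡ app a' b' → a ≡ a' × b ≡ b'
app-injective refl = refl , refl

record PlugOfRen {n n' k} (ρ : Fin n → Fin n') (s : Tm n) (L : SCtx n' k) (h : Tm k) : Set where
  constructor plugOfRen
  field
    {k₀} : ℕ
    L₀ : SCtx n k₀
    h₀ : Tm k₀
    σ : Fin k₀ → Fin k
    s≡ : s ≡ plug L₀ h₀
    isRen : RenCtx ρ L₀ L σ
    h≡ : h ≡ ren σ h₀

plug-ren⁻¹ : ∀ {n n' k} (ρ : Fin n → Fin n') (s : Tm n) (L : SCtx n' k) (h : Tm k) →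
  plug L h ≡ ren ρ s → PlugOfRen ρ s L h
plug-ren⁻¹ ρ s hole h eq = plugOfRen hole s ρ refl (hole (λ _ → refl)) eq
plug-ren⁻¹ ρ (es a b) (L [← u ]) h eq with es-injective eq
... | e₁ , e₂ with plug-ren⁻¹ (ext ρ) a L h e₁
... | plugOfRen L₀ h₀ σ refl r eqh = plugOfRen (L₀ [← b ]) h₀ σ refl (bind r (λ _ → refl) e₂) eqh

-- Reduction under renaming

plug-step : ∀ {n k j} (L : SCtx n j) {t t'} → Step k t t' → Step k (plug L t) (plug L t')
plug-step hole s = s
plug-step (L [← u ]) s = esL (plug-step L s)

var-irreducible : ∀ {n k} {i : Fin n} {t} → ¬ Step k (var i) t
var-irreducible (root ())

lam-irreducible : ∀ {n k} {t : Tm (suc n)} {t'} → ¬ Step k (lam t) t'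
lam-irreducible (root ())

val-irreducible : ∀ {n k k'} {h t : Tm n} → Val k h → ¬ Step k' h t
val-irreducible (var i) = var-irreducible
val-irreducible (lam t) = lam-irreducible

ren-e-root : ∀ {n m j k} (ρ : Fin n → Fin m) {h : Tm j} → Val k h → ∀ t L →
  Step k (ren ρ (es t (plug L h))) (ren ρ (eContractum t L h))
ren-e-root ρ {h} vh t L with renCtx ρ L
... | renamed L' σ r = subst₂ (Step _) (cong (es (ren (ext ρ) t)) (sym (ren-plug r h))) (sym (ren-eContractum r t h))
  (e-root (ren-val σ vh) (ren (ext ρ) t) L')

ren-step : ∀ {n n' k} (ρ : Fin n → Fin n') {t u} → Step k t u → Step k (ren ρ t) (ren ρ u)
ren-step ρ (root (rm L t u)) with renCtx ρ L
... | renamed L' σ r = subst₂ (Step m) (cong (λ z → app z (ren ρ u)) (sym (ren-plug r (lam t))))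
  (sym (ren-mContractum r t u)) (root (rm L' (ren (ext σ) t) (ren ρ u)))
ren-step ρ (root (reλ t L u)) = ren-e-root ρ (lam u) t L
ren-step ρ (root (revar t L y)) = ren-e-root ρ (var y) t L
ren-step ρ (appL s) = appL (ren-step ρ s)
ren-step ρ (appR s) = appR (ren-step ρ s)
ren-step ρ (esL s) = esL (ren-step (ext ρ) s)
ren-step ρ (esR s) = esR (ren-step ρ s)

StepOfRen : ∀ {n m} → Kind → (Fin n → Fin m) → Tm n → Tm m → Set
StepOfRen {n} k ρ s t' = Σ (Tm n) λ s' → t' ≡ ren ρ s' × Step k s s'

m-root-ren⁻¹ : ∀ {n n' j} {ρ : Fin n → Fin n'} (L : SCtx n' j) t u s →
  app (plug L (lam t)) u ≡ ren ρ s → StepOfRen m ρ s (mContractum L t u)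
m-root-ren⁻¹ {ρ = ρ} L t u (app s₁ s₂) eq with app-injective eq
... | e₁ , refl with plug-ren⁻¹ ρ s₁ L (lam t) e₁
... | plugOfRen L₀ (lam t₀) σ refl r refl =
  mContractum L₀ t₀ s₂ , sym (ren-mContractum r t₀ s₂) , root (rm L₀ t₀ s₂)
... | plugOfRen L₀ (var _) σ _ _ ()
... | plugOfRen L₀ (app _ _) σ _ _ ()
... | plugOfRen L₀ (es _ _) σ _ _ ()

e-root-ren⁻¹ : ∀ {n m j k} {ρ : Fin n → Fin m} {h : Tm j} → Val k h → ∀ t L s →
  es t (plug L h) ≡ ren ρ s → StepOfRen k ρ s (eContractum t L h)
e-root-ren⁻¹ {ρ = ρ} {h} vh t L (es a b) eq with es-injective eq
... | refl , e₂ with plug-ren⁻¹ ρ b L h e₂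
... | plugOfRen L₀ h₀ σ refl r refl =
  eContractum a L₀ h₀ , sym (ren-eContractum r a h₀) , e-root (ren-val⁻¹ h₀ vh) a L₀

ren-step⁻¹ : ∀ {n m k} (ρ : Fin n → Fin m) s {t t'} → Step k t t' → t ≡ ren ρ s → StepOfRen k ρ s t'
ren-step⁻¹ ρ s (root (rm L t u)) eq = m-root-ren⁻¹ L t u s eq
ren-step⁻¹ ρ s (root (reλ t L u)) eq = e-root-ren⁻¹ (lam u) t L s eq
ren-step⁻¹ ρ s (root (revar t L y)) eq = e-root-ren⁻¹ (var y) t L s eq
ren-step⁻¹ ρ (app s₁ s₂) (appL st) eq with app-injective eq
... | e₁ , refl with ren-step⁻¹ ρ s₁ st e₁
... | s₁' , refl , st' = app s₁' s₂ , refl , appL st'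
ren-step⁻¹ ρ (app s₁ s₂) (appR st) eq with app-injective eq
... | refl , e₂ with ren-step⁻¹ ρ s₂ st e₂
... | s₂' , refl , st' = app s₁ s₂' , refl , appR st'
ren-step⁻¹ ρ (es a b) (esL st) eq with es-injective eq
... | e₁ , refl with ren-step⁻¹ (ext ρ) a st e₁
... | a' , refl , st' = es a' b , refl , esL st'
ren-step⁻¹ ρ (es a b) (esR st) eq with es-injective eq
... | refl , e₂ with ren-step⁻¹ ρ b st e₂
... | b' , refl , st' = es a b' , refl , esR st'
ren-step⁻¹ ρ (app _ _) (esL _) ()
ren-step⁻¹ ρ (app _ _) (esR _) ()
ren-step⁻¹ ρ (es _ _) (appL _) ()
ren-step⁻¹ ρ (es _ _) (appR _) ()

-- Kernel terms

ren-valueK : ∀ {n m} (ρ : Fin n → Fin m) {v} → IsValueK v → IsValueK (ren ρ v)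
ren-kernel : ∀ {n m} (ρ : Fin n → Fin m) {t} → IsKernel t → IsKernel (ren ρ t)
ren-valueK ρ (kvar i) = kvar (ρ i)
ren-valueK ρ (klam k) = klam (ren-kernel (ext ρ) k)
ren-kernel ρ (kval v) = kval (ren-valueK ρ v)
ren-kernel ρ (kapp k v) = kapp (ren-kernel ρ k) (ren-valueK ρ v)
ren-kernel ρ (kes k k') = kes (ren-kernel (ext ρ) k) (ren-kernel ρ k')

exts-valueK : ∀ {n m} {σ : Fin n → Tm m} → (∀ i → IsValueK (σ i)) → ∀ i → IsValueK (exts σ i)
exts-valueK h zero = kvar zero
exts-valueK h (suc i) = ren-valueK suc (h i)

sub-valueK : ∀ {n m} {σ : Fin n → Tm m} → (∀ i → IsValueK (σ i)) → ∀ {v} → IsValueK v → IsValueK (sub σ v)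
sub-kernel : ∀ {n m} {σ : Fin n → Tm m} → (∀ i → IsValueK (σ i)) → ∀ {t} → IsKernel t → IsKernel (sub σ t)
sub-valueK h (kvar i) = h i
sub-valueK h (klam k) = klam (sub-kernel (exts-valueK h) k)
sub-kernel h (kval v) = kval (sub-valueK h v)
sub-kernel h (kapp k v) = kapp (sub-kernel h k) (sub-valueK h v)
sub-kernel h (kes k k') = kes (sub-kernel (exts-valueK h) k) (sub-kernel h k')

subst0-kernel : ∀ {n} {t : Tm (suc n)} {v} → IsKernel t → IsValueK v → IsKernel (subst0 t v)
subst0-kernel {t = t} {v} kt kv =
  subst IsKernel (sym (subst0≡sub t v)) (sub-kernel (λ { zero → kv ; (suc i) → kvar i }) kt)

plug-kernel : ∀ {n j} (L : SCtx n j) {t t'} → IsKernel (plug L t) → (IsKernel t → IsKernel t') → IsKernel (plug L t')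
plug-kernel hole k f = f k
plug-kernel (L [← u ]) (kes k k') f = kes (plug-kernel L k f) k'

valueK-irreducible : ∀ {n k} {v t : Tm n} → IsValueK v → ¬ Step k v t
valueK-irreducible (kvar i) = var-irreducible
valueK-irreducible (klam _) = lam-irreducible

step-kernel : ∀ {n k} {t t' : Tm n} → Step k t t' → IsKernel t → IsKernel t'
step-kernel (root (rm L t u)) (kapp p q) = plug-kernel L p λ { (kval (klam kt)) → kes kt (kval (ren-valueK (under L) q)) }
step-kernel (root (reλ t L u)) (kes kt kp) = plug-kernel L kp λ { (kval v) → subst0-kernel (ren-kernel (ext (under L)) kt) v }
step-kernel (root (revar t L y)) (kes kt kp) = plug-kernel L kp λ { (kval v) → subst0-kernel (ren-kernel (ext (under L)) kt) v }
step-kernel (appL s) (kapp p q) = kapp (step-kernel s p) q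
step-kernel (appR s) (kapp p q) = ⊥-elim (valueK-irreducible q s)
step-kernel (esL s) (kes p q) = kes (step-kernel s p) q
step-kernel (esR s) (kes p q) = kes p (step-kernel s q)
step-kernel s (kval v) = ⊥-elim (valueK-irreducible v s)

tr-kernel : ∀ {n} (t : Tm n) → IsKernel (tr t)
tr-kernel (var i) = kval (kvar i)
tr-kernel (lam t) = kval (klam (tr-kernel t))
tr-kernel (app t u) = kes (kapp (ren-kernel suc (tr-kernel t)) (kvar zero)) (tr-kernel u)
tr-kernel (es t u) = kes (tr-kernel t) (tr-kernel u)

infixr 5 _◅◅_

_◅◅_ : ∀ {n} {R : Kind → Tm n → Tm n → Set} {a b c} → Deriv R a b → Deriv R b c → Deriv R a c
ε ◅◅ d = d
(s ◅ d) ◅◅ d' = s ◅ (d ◅◅ d')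

count-◅◅ : ∀ {n} {R : Kind → Tm n → Tm n → Set} {a b c} k (d₁ : Deriv R a b) (d₂ : Deriv R b c) →
  count k (d₁ ◅◅ d₂) ≡ count k d₁ + count k d₂
count-◅◅ k ε d₂ = refl
count-◅◅ k (_◅_ {k'} s d₁) d₂ =
  trans (cong (sameK k k' +_) (count-◅◅ k d₁ d₂)) (sym (+-assoc (sameK k k') (count k d₁) (count k d₂)))

map-deriv : ∀ {n n'} (F : Tm n → Tm n') → (∀ {k a b} → Step k a b → Step k (F a) (F b)) →
  ∀ {a b} → Deriv Step a b → Deriv Step (F a) (F b)
map-deriv F f ε = ε
map-deriv F f (s ◅ d) = f s ◅ map-deriv F f d

count-map-deriv : ∀ {n n'} (F : Tm n → Tm n') (f : ∀ {k a b} → Step k a b → Step k (F a) (F b)) {a b}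
  (d : Deriv Step a b) k → count k (map-deriv F f d) ≡ count k d
count-map-deriv F f ε k = refl
count-map-deriv F f (_◅_ {k'} s d) k = cong (sameK k k' +_) (count-map-deriv F f d k)

deriv-kernel : ∀ {n} {a b : Tm n} → IsKernel a → Deriv Step a b → IsKernel b
deriv-kernel ka ε = ka
deriv-kernel ka (s ◅ d) = deriv-kernel (step-kernel s ka) d

kernel-deriv : ∀ {n} {a b : Tm n} → IsKernel a → (d : Deriv Step a b) →
  Σ (Deriv StepK a b) λ e → ∀ k → count k e ≡ count k d
kernel-deriv ka ε = ε , λ k → refl
kernel-deriv ka (_◅_ {k'} s d) with kernel-deriv (step-kernel s ka) d
... | e , c = (ka , step-kernel s ka , s) ◅ e , λ k → cong (sameK k k' +_) (c k)

-- Commutation of explicit substitutions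

infix 4 _≈₁_ _≈_

-- Taking s' with an equation s' ≡ wk s, rather than wk s itself, lets ≈com be matched
-- against arbitrary terms.
data _≈₁_ : ∀ {n} → Tm n → Tm n → Set where
  ≈com : ∀ {n} (t : Tm (suc (suc n))) {s' : Tm (suc n)} (s u : Tm n) → s' ≡ wk s →
         es (es t s') u ≈₁ es (es (ren swap01 t) (wk u)) s
  ≈appL : ∀ {n} {a a' b : Tm n} → a ≈₁ a' → app a b ≈₁ app a' b
  ≈appR : ∀ {n} {a b b' : Tm n} → b ≈₁ b' → app a b ≈₁ app a b'
  ≈esL : ∀ {n} {a a' : Tm (suc n)} {b : Tm n} → a ≈₁ a' → es a b ≈₁ es a' b
  ≈esR : ∀ {n} {a : Tm (suc n)} {b b' : Tm n} → b ≈₁ b' → es a b ≈₁ es a b'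

_≈_ : ∀ {n} → Tm n → Tm n → Set
_≈_ = Star _≈₁_

≈-trans : ∀ {n} {a b c : Tm n} → a ≈ b → b ≈ c → a ≈ c
≈-trans = Star._◅◅_

≡⇒≈ : ∀ {n} {a b : Tm n} → a ≡ b → a ≈ b
≡⇒≈ refl = ε

≈₁⇒≡s : ∀ {n} {a b : Tm n} → a ≈₁ b → a ≡s b
≈₁⇒≡s (≈com t s u refl) = ≡com t s u
≈₁⇒≡s (≈appL p) = ≡appL (≈₁⇒≡s p)
≈₁⇒≡s (≈appR p) = ≡appR (≈₁⇒≡s p)
≈₁⇒≡s (≈esL p) = ≡esL (≈₁⇒≡s p)
≈₁⇒≡s (≈esR p) = ≡esR (≈₁⇒≡s p)

≈⇒≡s : ∀ {n} {a b : Tm n} → a ≈ b → a ≡s b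
≈⇒≡s = Star.fold _≡s_ (λ p q → ≡trans (≈₁⇒≡s p) q) ≡refl

swap01-involutive : ∀ {n} → swap01 {n} ∘ swap01 ≗ id
swap01-involutive zero = refl
swap01-involutive (suc zero) = refl
swap01-involutive (suc (suc i)) = refl

ren-swap01-involutive : ∀ {n} (t : Tm (suc (suc n))) → ren swap01 (ren swap01 t) ≡ t
ren-swap01-involutive t = trans (ren-ren swap01 swap01 t) (ren-≗id swap01-involutive t)

≈₁-sym : ∀ {n} {a b : Tm n} → a ≈₁ b → b ≈₁ a
≈₁-sym (≈com t s u refl) = subst (λ z → es (es (ren swap01 t) (wk u)) s ≈₁ es (es z (wk s)) u)
  (ren-swap01-involutive t) (≈com (ren swap01 t) u s refl)
≈₁-sym (≈appL p) = ≈appL (≈₁-sym p)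
≈₁-sym (≈appR p) = ≈appR (≈₁-sym p)
≈₁-sym (≈esL p) = ≈esL (≈₁-sym p)
≈₁-sym (≈esR p) = ≈esR (≈₁-sym p)

≈-sym : ∀ {n} {a b : Tm n} → a ≈ b → b ≈ a
≈-sym = reverse ≈₁-sym

≈₁-plug : ∀ {n j} (L : SCtx n j) {a b} → a ≈₁ b → plug L a ≈₁ plug L b
≈₁-plug hole p = p
≈₁-plug (L [← u ]) p = ≈esL (≈₁-plug L p)

exts²-swap01 : ∀ {n m} (σ : Fin n → Tm m) → exts (exts σ) ∘ swap01 ≗ ren swap01 ∘ exts (exts σ)
exts²-swap01 σ zero = refl
exts²-swap01 σ (suc zero) = refl
exts²-swap01 σ (suc (suc i)) =
  trans (ren-ren suc suc (σ i)) (sym (trans (ren-ren swap01 suc (wk (σ i))) (ren-ren (swap01 ∘ suc) suc (σ i))))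

sub-swap01 : ∀ {n m} (σ : Fin n → Tm m) t →
  sub (exts (exts σ)) (ren swap01 t) ≡ ren swap01 (sub (exts (exts σ)) t)
sub-swap01 σ t = trans (sub-ren (exts (exts σ)) swap01 t)
  (trans (sub-cong (exts²-swap01 σ) t) (sym (ren-sub swap01 (exts (exts σ)) t)))

≈₁-sub : ∀ {n m} (σ : Fin n → Tm m) {a b} → a ≈₁ b → sub σ a ≈₁ sub σ b
≈₁-sub σ (≈com t s u refl) =
  subst₂ _≈₁_ (cong (λ z → es (es (sub (exts (exts σ)) t) z) (sub σ u)) (wk-sub σ s))
    (cong₂ (λ z w → es (es z w) (sub σ s)) (sym (sub-swap01 σ t)) (wk-sub σ u))
    (≈com (sub (exts (exts σ)) t) (sub σ s) (sub σ u) refl)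
≈₁-sub σ (≈appL p) = ≈appL (≈₁-sub σ p)
≈₁-sub σ (≈appR p) = ≈appR (≈₁-sub σ p)
≈₁-sub σ (≈esL p) = ≈esL (≈₁-sub (exts σ) p)
≈₁-sub σ (≈esR p) = ≈esR (≈₁-sub σ p)

≈₁-ren : ∀ {n m} (ρ : Fin n → Fin m) {a b} → a ≈₁ b → ren ρ a ≈₁ ren ρ b
≈₁-ren ρ {a} {b} p = subst₂ _≈₁_ (sym (ren≡sub ρ a)) (sym (ren≡sub ρ b)) (≈₁-sub (var ∘ ρ) p)

≈₁-subst0 : ∀ {n} {a b : Tm (suc n)} (v : Tm n) → a ≈₁ b → subst0 a v ≈₁ subst0 b v
≈₁-subst0 {a = a} {b} v p = subst₂ _≈₁_ (sym (subst0≡sub a v)) (sym (subst0≡sub b v)) (≈₁-sub (single v) p)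

record Rearrangement {n k} (L : SCtx n k) (h : Tm k) (t : Tm n) : Set where
  constructor rearranged
  field
    {k'} : ℕ
    L' : SCtx n k'
    π : Fin k → Fin k'
    t≡ : t ≡ plug L' (ren π h)
    plug-≈₁ : ∀ s → plug L s ≈₁ plug L' (ren π s)
    under≡ : under L' ≗ π ∘ under L

≈esR-rearrangement : ∀ {n j} (L : SCtx (suc n) j) (w : Tm n) (h : Tm j) {w'} → w ≈₁ w' →
  Rearrangement (L [← w ]) h (es (plug L h) w')
≈esR-rearrangement L w h {w'} p =
  rearranged (L [← w' ]) id (cong (λ z → es (plug L z) w') (sym (ren-id h)))
    (λ s → subst (λ z → es (plug L s) w ≈₁ es (plug L z) w') (sym (ren-id s)) (≈esR p)) (λ _ → refl)

plug-val-≈₁ : ∀ {n j k} (L : SCtx n j) (h : Tm j) → Val k h → ∀ {t} → plug L h ≈₁ t → Rearrangement L h t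
plug-val-≈₁ (hole [← w ]) h vh (≈esR p) = ≈esR-rearrangement hole w h p
plug-val-≈₁ ((L [← w₂ ]) [← w ]) h vh (≈esR p) = ≈esR-rearrangement (L [← w₂ ]) w h p
plug-val-≈₁ ((L [← w₂ ]) [← w ]) h vh (≈esL p) with plug-val-≈₁ (L [← w₂ ]) h vh p
... | rearranged L' π eq rel und = rearranged (L' [← w ]) π (cong (λ z → es z w) eq) (λ s → ≈esL (rel s)) (und ∘ suc)
plug-val-≈₁ ((L [← w₂ ]) [← w ]) h vh (≈com .(plug L h) s .w eq) with renCtx swap01 L
... | renamed L₃ σ₃ r =
  rearranged ((L₃ [← wk w ]) [← s ]) σ₃ (cong (λ z → es (es z (wk w)) s) (ren-plug r h))
    (λ s' → subst (λ z → es (es (plug L s') w₂) w ≈₁ es (es z (wk w)) s) (ren-plug r s') (≈com (plug L s') s w eq))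
    (λ i → under-ren r (suc (suc i)))
plug-val-≈₁ hole (var i) (var i) ()
plug-val-≈₁ hole (lam t) (lam t) ()
plug-val-≈₁ (hole [← w ]) (var i) (var i) (≈esL ())
plug-val-≈₁ (hole [← w ]) (lam t) (lam t) (≈esL ())

swap01-ext-suc : ∀ {n} → swap01 {n} ∘ ext suc ≗ suc
swap01-ext-suc zero = refl
swap01-ext-suc (suc i) = refl

-- L' is L weakened for the binder x of [x←B]; A refers to x through the hole renaming.
es-float : ∀ {n j} (L : SCtx n j) {j'} {L' : SCtx (suc n) j'} {σ : Fin j → Fin j'} → RenCtx suc L L' σ →
  ∀ (A : Tm (suc j)) (B : Tm n) → es (plug L' (ren (under L' zero ∷ σ) A)) B ≈ plug L (es A (ren (under L) B))
es-float hole (hole e) A B =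
  ≡⇒≈ (cong₂ es (ren-≗id (λ { zero → refl ; (suc i) → e i }) A) (sym (ren-id B)))
es-float {j = j} (L [← w ]) {j'} {L' = L' [← w' ]} {σ} (bind r e q) A B with renCtx swap01 L'
... | renamed L₃ σ₃ r₃ =
  ≈com (plug L' (ren c A)) w B q ◅
  ≈-trans (≡⇒≈ (cong (λ z → es (es z (wk B)) w) swapped))
  (≈-trans (gmap (λ z → es z w) ≈esL (es-float L r' A (wk B)))
  (≡⇒≈ (cong (λ z → es (plug L (es A z)) w) (ren-ren (under L) suc B))))
  where
  c : Fin (suc j) → Fin j'
  c = under L' (suc zero) ∷ σ
  r' : RenCtx suc L L₃ (σ₃ ∘ σ)
  r' = renCtx-cong (renCtx-∘ r₃ r) (λ i → trans (cong swap01 (e i)) (swap01-ext-suc i))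
  swapped : ren swap01 (plug L' (ren c A)) ≡ plug L₃ (ren (under L₃ zero ∷ σ₃ ∘ σ) A)
  swapped = trans (ren-plug r₃ (ren c A)) (cong (plug L₃) (trans (ren-ren σ₃ c A)
    (ren-cong (λ { zero → sym (under-ren r₃ (suc zero)) ; (suc i) → refl }) A)))

subst0-swap01 : ∀ {n j j₀} {L₀ : SCtx n j₀} {L : SCtx (suc n) j} {σ} → RenCtx suc L₀ L σ →
  (t : Tm (suc (suc n))) (h₀ : Tm j₀) →
  subst0 (ren (ext (under L)) (ren swap01 t)) (ren σ h₀)
    ≡ ren (under L zero ∷ σ) (sub (exts (single h₀)) (ren (ext (ext (under L₀))) t))
subst0-swap01 {j = j} {j₀} {L₀ = L₀} {L} {σ} r t h₀ = begin
  subst0 (ren (ext (under L)) (ren swap01 t)) (ren σ h₀)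
    ≡⟨ subst0≡sub (ren (ext (under L)) (ren swap01 t)) (ren σ h₀) ⟩
  sub (single (ren σ h₀)) (ren (ext (under L)) (ren swap01 t))
    ≡⟨ cong (sub (single (ren σ h₀))) (ren-ren (ext (under L)) swap01 t) ⟩
  sub (single (ren σ h₀)) (ren (ext (under L) ∘ swap01) t)
    ≡⟨ sub-ren (single (ren σ h₀)) (ext (under L) ∘ swap01) t ⟩
  sub (single (ren σ h₀) ∘ ext (under L) ∘ swap01) t
    ≡⟨ sub-cong pointwise t ⟩
  sub (ren c ∘ exts (single h₀) ∘ ext (ext (under L₀))) t
    ≡⟨ sym (ren-sub c (exts (single h₀) ∘ ext (ext (under L₀))) t) ⟩
  ren c (sub (exts (single h₀) ∘ ext (ext (under L₀))) t)
    ≡⟨ cong (ren c) (sym (sub-ren (exts (single h₀)) (ext (ext (under L₀))) t)) ⟩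
  ren c (sub (exts (single h₀)) (ren (ext (ext (under L₀))) t)) ∎
  where
  open ≡-Reasoning
  c : Fin (suc j₀) → Fin j
  c = under L zero ∷ σ
  pointwise : single (ren σ h₀) ∘ ext (under L) ∘ swap01 ≗ ren c ∘ exts (single h₀) ∘ ext (ext (under L₀))
  pointwise zero = refl
  pointwise (suc zero) = sym (ren-ren c suc h₀)
  pointwise (suc (suc i)) = cong var (under-ren r i)

StepUpTo≈ : ∀ {n} → Kind → Tm n → Tm n → Set
StepUpTo≈ {n} k b a' = Σ (Tm n) λ b' → Step k b b' × a' ≈ b'

≈com-e-root : ∀ {n j k} {h : Tm j} → Val k h → (t : Tm (suc (suc n))) {s' : Tm (suc n)} (s : Tm n) (L : SCtx n j) →
  s' ≡ wk s → StepUpTo≈ k (es (es (ren swap01 t) (wk (plug L h))) s) (eContractum (es t s') L h)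
≈com-e-root {j = j} {h = h} vh t s L refl with renCtx suc L
... | renamed L₁ σ r =
  es (eContractum (ren swap01 t) L₁ (ren σ h)) s ,
  subst₂ (Step _) (cong (λ z → es (es (ren swap01 t) z) s) (sym (ren-plug r h))) refl
    (esL (e-root (ren-val σ vh) (ren swap01 t) L₁)) ,
  ≈-trans (≡⇒≈ (cong (plug L) contractum≡))
    (≈-trans (≈-sym (es-float L r A s)) (≡⇒≈ (cong (λ z → es (plug L₁ z) s) (sym (subst0-swap01 r t h)))))
  where
  A : Tm (suc j)
  A = sub (exts (single h)) (ren (ext (ext (under L))) t)
  contractum≡ : subst0 (ren (ext (under L)) (es t (wk s))) h ≡ es A (ren (under L) s)
  contractum≡ = trans (subst0≡sub (ren (ext (under L)) (es t (wk s))) h) (cong (es A) (sub-single-wk (under L) s h))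

≈com-esL-e-root : ∀ {n j k} {h : Tm j} → Val k h → (t : Tm (suc (suc n))) (s u : Tm n) (L : SCtx (suc n) j) →
  plug L h ≡ wk s → StepUpTo≈ k (es (es (ren swap01 t) (wk u)) s) (es (eContractum t L h) u)
≈com-esL-e-root {h = h} vh t s u L eq with plug-ren⁻¹ suc s L h eq
... | plugOfRen {j₀} L₀ h₀ σ refl r refl =
  eContractum (es (ren swap01 t) (wk u)) L₀ h₀ ,
  e-root (ren-val⁻¹ h₀ vh) (es (ren swap01 t) (wk u)) L₀ ,
  ≈-trans (≡⇒≈ (cong (λ z → es (plug L z) u) inner≡)) (≈-trans (es-float L₀ r A u) (≡⇒≈ (sym outer≡)))
  where
  A : Tm (suc j₀)
  A = sub (exts (single h₀)) (ren (ext (ext (under L₀))) (ren swap01 t))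
  inner≡ : subst0 (ren (ext (under L)) t) (ren σ h₀) ≡ ren (under L zero ∷ σ) A
  inner≡ = trans (cong (λ z → subst0 (ren (ext (under L)) z) (ren σ h₀)) (sym (ren-swap01-involutive t)))
    (subst0-swap01 r (ren swap01 t) h₀)
  outer≡ : eContractum (es (ren swap01 t) (wk u)) L₀ h₀ ≡ plug L₀ (es A (ren (under L₀) u))
  outer≡ = cong (plug L₀) (trans (subst0≡sub (ren (ext (under L₀)) (es (ren swap01 t) (wk u))) h₀)
    (cong (es A) (sub-single-wk (under L₀) u h₀)))

≈esR-e-root : ∀ {n j k} {h : Tm j} → Val k h → (t : Tm (suc n)) (L : SCtx n j) {u : Tm n} →
  plug L h ≈₁ u → StepUpTo≈ k (es t u) (eContractum t L h)
≈esR-e-root {h = h} vh t L p with plug-val-≈₁ L h vh p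
... | rearranged L' π refl rel und =
  _ , e-root (ren-val π vh) t L' ,
  return (subst (λ z → eContractum t L h ≈₁ plug L' z) contractum≡ (rel (subst0 (ren (ext (under L)) t) h)))
  where
  contractum≡ : ren π (subst0 (ren (ext (under L)) t) h) ≡ subst0 (ren (ext (under L')) t) (ren π h)
  contractum≡ = trans (ren-subst0 π (ren (ext (under L)) t) h) (cong (λ z → subst0 z (ren π h))
    (trans (ren-ren (ext π) (ext (under L)) t) (ren-cong (λ i → trans (ext-∘ π (under L) i) (ext-cong (sym ∘ und) i)) t)))

≈appL-m-root : ∀ {n j} (L : SCtx n j) (t : Tm (suc j)) (u : Tm n) {b} →
  plug L (lam t) ≈₁ b → StepUpTo≈ m (app b u) (mContractum L t u)
≈appL-m-root L t u p with plug-val-≈₁ L (lam t) (lam t) p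
... | rearranged L' π refl rel und =
  _ , root (rm L' (ren (ext π) t) u) ,
  return (subst (λ z → mContractum L t u ≈₁ plug L' (es (ren (ext π) t) z)) arg≡ (rel (es t (ren (under L) u))))
  where
  arg≡ : ren π (ren (under L) u) ≡ ren (under L') u
  arg≡ = trans (ren-ren π (under L) u) (ren-cong (sym ∘ und) u)

≈₁-simulation : ∀ {n k} {a b a' : Tm n} → a ≈₁ b → Step k a a' → StepUpTo≈ k b a'
≈₁-simulation (≈com t s u eq) (root (reλ _ L v)) = ≈com-e-root (lam v) t s L eq
≈₁-simulation (≈com t s u eq) (root (revar _ L y)) = ≈com-e-root (var y) t s L eq
≈₁-simulation (≈com t s u eq) (esL (root (reλ _ L v))) = ≈com-esL-e-root (lam v) t s u L eq
≈₁-simulation (≈com t s u eq) (esL (root (revar _ L y))) = ≈com-esL-e-root (var y) t s u L eq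
≈₁-simulation (≈com t s u eq) (esL (esL st)) = _ , esL (esL (ren-step swap01 st)) , return (≈com _ s u eq)
≈₁-simulation (≈com t s u refl) (esL (esR st)) with ren-step⁻¹ suc s st refl
... | s₁ , refl , st₁ = _ , esR st₁ , return (≈com t s₁ u refl)
≈₁-simulation (≈com t s u eq) (esR st) = _ , esL (esR (ren-step suc st)) , return (≈com t s _ eq)
≈₁-simulation (≈appL p) (root (rm L t u)) = ≈appL-m-root L t u p
≈₁-simulation (≈appL p) (appL st) with ≈₁-simulation p st
... | _ , st' , r = _ , appL st' , gmap (λ z → app z _) ≈appL r
≈₁-simulation (≈appL p) (appR st) = _ , appR st , return (≈appL p)
≈₁-simulation (≈appR p) (root (rm L t u)) = _ , root (rm L t _) , return (≈₁-plug L (≈esR (≈₁-ren (under L) p)))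
≈₁-simulation (≈appR p) (appL st) = _ , appL st , return (≈appR p)
≈₁-simulation (≈appR p) (appR st) with ≈₁-simulation p st
... | _ , st' , r = _ , appR st' , gmap (app _) ≈appR r
≈₁-simulation (≈esL p) (root (reλ t L v)) =
  _ , root (reλ _ L v) , return (≈₁-plug L (≈₁-subst0 (lam v) (≈₁-ren (ext (under L)) p)))
≈₁-simulation (≈esL p) (root (revar t L y)) =
  _ , root (revar _ L y) , return (≈₁-plug L (≈₁-subst0 (var y) (≈₁-ren (ext (under L)) p)))
≈₁-simulation (≈esL p) (esL st) with ≈₁-simulation p st
... | _ , st' , r = _ , esL st' , gmap (λ z → es z _) ≈esL r
≈₁-simulation (≈esL p) (esR st) = _ , esR st , return (≈esL p)
≈₁-simulation (≈esR p) (root (reλ t L v)) = ≈esR-e-root (lam v) t L p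
≈₁-simulation (≈esR p) (root (revar t L y)) = ≈esR-e-root (var y) t L p
≈₁-simulation (≈esR p) (esL st) = _ , esL st , return (≈esR p)
≈₁-simulation (≈esR p) (esR st) with ≈₁-simulation p st
... | _ , st' , r = _ , esR st' , gmap (es _) ≈esR r

≈-simulation : ∀ {n k} {a b a' : Tm n} → a ≈ b → Step k a a' → StepUpTo≈ k b a'
≈-simulation ε st = _ , st , ε
≈-simulation (p ◅ ps) st with ≈₁-simulation p st
... | _ , st' , r₁ with ≈-simulation ps st'
... | b' , st'' , r₂ = b' , st'' , ≈-trans r₁ r₂

-- Simulation by the translation

≈-simulation* : ∀ {n} {a b a' : Tm n} → a ≈ b → (d : Deriv Step a a') →
  Σ (Tm n) λ b' → Σ (Deriv Step b b') λ D → a' ≈ b' × (∀ k → count k D ≡ count k d)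
≈-simulation* p ε = _ , ε , p , λ k → refl
≈-simulation* p (_◅_ {k'} st d) with ≈-simulation p st
... | _ , st' , r with ≈-simulation* r d
... | b' , D , r' , c = b' , st' ◅ D , r' , λ k → cong (sameK k k' +_) (c k)

≈-simulationᵉ : ∀ {n} {a b a' : Tm n} → a ≈ b → Deriv StepE a a' → Σ (Tm n) λ b' → Deriv StepE b b' × a' ≈ b'
≈-simulationᵉ p ε = _ , ε , p
≈-simulationᵉ p ((isE , st) ◅ d) with ≈-simulation p st
... | _ , st' , r with ≈-simulationᵉ r d
... | b' , D , r' = b' , (isE , st') ◅ D , r'

-- An m-step is simulated by an m-step followed by the e_var-step firing the administrative redex.
simCost : Kind → Kind → ℕ
simCost k' m = sameK k' m + sameK k' evar
simCost k' eλ = sameK k' eλ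
simCost k' evar = sameK k' evar

record TrSimulation {n} (k : Kind) (t u : Tm n) : Set where
  constructor trSimulation
  field
    {w} : Tm n
    D : Deriv Step (tr t) w
    w≈ : w ≈ tr u
    counts : ∀ k' → count k' D ≡ simCost k' k

tr-simulation-e-root : ∀ {n j k} {h : Tm j} → Val k h → (t : Tm (suc n)) (L : SCtx n j) →
  TrSimulation k (es t (plug L h)) (eContractum t L h)
tr-simulation-e-root {h = h} vh t L =
  trSimulation (subst₂ (Step _) (cong (es (tr t)) (sym (tr-plug L h))) refl (e-root (tr-val vh) (tr t) (trCtx L))
                ◅ ε)
    (≡⇒≈ (sym (tr-eContractum t L h))) (λ k' → trans (+-identityʳ (sameK k' _)) (e-cost vh k'))
  where
  e-cost : ∀ {j k} {h : Tm j} → Val k h → ∀ k' → sameK k' k ≡ simCost k' k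
  e-cost (var _) k' = refl
  e-cost (lam _) k' = refl

subst0-ren-var : ∀ {n k} (σ : Fin n → Fin k) (t : Tm (suc n)) (j : Fin k) →
  subst0 (ren (ext σ) t) (var j) ≡ ren (j ∷ σ) t
subst0-ren-var σ t j = begin
  subst0 (ren (ext σ) t) (var j)         ≡⟨ subst0≡sub (ren (ext σ) t) (var j) ⟩
  sub (single (var j)) (ren (ext σ) t)   ≡⟨ sub-ren (single (var j)) (ext σ) t ⟩
  sub (single (var j) ∘ ext σ) t         ≡⟨ sub-cong (λ { zero → refl ; (suc i) → refl }) t ⟩
  sub (var ∘ (j ∷ σ)) t                  ≡⟨ sym (ren≡sub (j ∷ σ) t) ⟩
  ren (j ∷ σ) t                          ∎
  where open ≡-Reasoning

tr-simulation-m-root : ∀ {n j} (L : SCtx n j) (t : Tm (suc j)) (u : Tm n) →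
  TrSimulation m (app (plug L (lam t)) u) (mContractum L t u)
tr-simulation-m-root L t u with renCtx suc (trCtx L)
... | renamed {j₁} L₁ σ r =
  trSimulation (subst₂ (Step m) (cong (λ z → es (app z (var zero)) (tr u)) source≡) refl
                  (esL (root (rm L₁ t' (var zero))))
                ◅ esL (plug-step L₁ (root (revar t' hole x))) ◅ ε)
    (≈-trans (≡⇒≈ (cong (λ z → es (plug L₁ z) (tr u)) contractum≡))
      (≈-trans (es-float (trCtx L) r (tr t) (tr u)) (≡⇒≈ (sym (tr-mContractum L t u)))))
    (λ k' → cong (sameK k' m +_) (+-identityʳ (sameK k' evar)))
  where
  t' : Tm (suc j₁)
  t' = ren (ext σ) (tr t)
  x : Fin j₁
  x = under L₁ zero
  source≡ : plug L₁ (lam t') ≡ wk (tr (plug L (lam t)))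
  source≡ = sym (trans (cong wk (tr-plug L (lam t))) (ren-plug r (lam (tr t))))
  contractum≡ : subst0 (ren (ext id) t') (var x) ≡ ren (x ∷ σ) (tr t)
  contractum≡ = trans (cong (λ z → subst0 z (var x)) (ren-≗id (ext-id (λ _ → refl)) t')) (subst0-ren-var σ (tr t) x)

lift-tr-simulation : ∀ {n n' k} {t t' : Tm n} {u u' : Tm n'} (F : Tm n → Tm n')
  (f : ∀ {k a b} → Step k a b → Step k (F a) (F b)) (g : ∀ {a b} → a ≈₁ b → F a ≈₁ F b) →
  tr u ≡ F (tr t) → tr u' ≡ F (tr t') → TrSimulation k t t' → TrSimulation k u u'
lift-tr-simulation F f g e₁ e₂ (trSimulation D w≈ counts) =
  trSimulation (subst (λ z → Deriv Step z _) (sym e₁) (map-deriv F f D)) (≈-trans (gmap F g w≈) (≡⇒≈ (sym e₂)))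
    (λ k' → trans (count-subst e₁ k') (trans (count-map-deriv F f D k') (counts k')))
  where
  count-subst : ∀ {a b c} (e : a ≡ b) {d : Deriv Step b c} k' →
    count k' (subst (λ z → Deriv Step z c) (sym e) d) ≡ count k' d
  count-subst refl k' = refl

tr-simulation : ∀ {n k} {t u : Tm n} → Step k t u → TrSimulation k t u
tr-simulation (root (rm L t u)) = tr-simulation-m-root L t u
tr-simulation (root (reλ t L u)) = tr-simulation-e-root (lam u) t L
tr-simulation (root (revar t L y)) = tr-simulation-e-root (var y) t L
tr-simulation {t = app t₁ t₂} (appL st) = lift-tr-simulation (λ z → es (app (wk z) (var zero)) (tr t₂))
  (esL ∘ appL ∘ ren-step suc) (≈esL ∘ ≈appL ∘ ≈₁-ren suc) refl refl (tr-simulation st)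
tr-simulation {t = app t₁ t₂} (appR st) =
  lift-tr-simulation (es (app (wk (tr t₁)) (var zero))) esR ≈esR refl refl (tr-simulation st)
tr-simulation {t = es t₁ t₂} (esL st) = lift-tr-simulation (λ z → es z (tr t₂)) esL ≈esL refl refl (tr-simulation st)
tr-simulation {t = es t₁ t₂} (esR st) = lift-tr-simulation (es (tr t₁)) esR ≈esR refl refl (tr-simulation st)

simCount : ∀ {n} {R : Kind → Tm n → Tm n → Set} {t u : Tm n} → Kind → Deriv R t u → ℕ
simCount k' ε = 0
simCount k' (_◅_ {k} _ d) = simCost k' k + simCount k' d

simCount-m : ∀ {n} {R : Kind → Tm n → Tm n → Set} {t u : Tm n} (d : Deriv R t u) → simCount m d ≡ count m d
simCount-m ε = refl
simCount-m (_◅_ {m} _ d) = cong suc (simCount-m d)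
simCount-m (_◅_ {eλ} _ d) = simCount-m d
simCount-m (_◅_ {evar} _ d) = simCount-m d

simCount-eλ : ∀ {n} {R : Kind → Tm n → Tm n → Set} {t u : Tm n} (d : Deriv R t u) → simCount eλ d ≡ count eλ d
simCount-eλ ε = refl
simCount-eλ (_◅_ {m} _ d) = simCount-eλ d
simCount-eλ (_◅_ {eλ} _ d) = cong suc (simCount-eλ d)
simCount-eλ (_◅_ {evar} _ d) = simCount-eλ d

simCount-evar : ∀ {n} {R : Kind → Tm n → Tm n → Set} {t u : Tm n} (d : Deriv R t u) →
  simCount evar d ≡ count evar d + count m d
simCount-evar ε = refl
simCount-evar (_◅_ {k} _ d) = trans (cong₂ _+_ (cost k) (simCount-evar d)) (interchange (sameK evar k) (sameK m k) _ _)
  where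
  cost : ∀ k → simCost evar k ≡ sameK evar k + sameK m k
  cost m = refl
  cost eλ = refl
  cost evar = refl

tr-simulation* : ∀ {n} {t u s : Tm n} (d : Deriv Step t u) → s ≈ tr t →
  Σ (Tm n) λ s' → Σ (Deriv Step s s') λ D → s' ≈ tr u × (∀ k → count k D ≡ simCount k d)
tr-simulation* ε p = _ , ε , p , λ k → refl
tr-simulation* (_◅_ {k} st d) p with tr-simulation st
... | trSimulation D₁ w≈ c₁ with ≈-simulation* (≈-sym p) D₁
... | _ , D₁' , r₁ , c₁' with tr-simulation* d (≈-trans (≈-sym r₁) w≈)
... | s' , D₂ , r₂ , c₂ = s' , D₁' ◅◅ D₂ , r₂ ,
  λ k' → trans (count-◅◅ k' D₁' D₂) (cong₂ _+_ (trans (c₁' k') (c₁ k')) (c₂ k'))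

-- Normal forms

data LLam {n} : Tm n → Set where
  ll-lam : ∀ {t} → LLam (lam t)
  ll-es : ∀ {c d} → LLam c → LLam (es c d)

data LVal {n} : Tm n → Set where
  lv-var : ∀ {i} → LVal (var i)
  lv-lam : ∀ {t} → LVal (lam t)
  lv-es : ∀ {c d} → LVal c → LVal (es c d)

data Normal : ∀ {n} → Tm n → Set where
  var : ∀ {n} {i : Fin n} → Normal (var i)
  lam : ∀ {n} {t : Tm (suc n)} → Normal (lam t)
  app : ∀ {n} {a b : Tm n} → Normal a → Normal b → ¬ LLam a → Normal (app a b)
  es : ∀ {n} {c : Tm (suc n)} {d : Tm n} → Normal c → Normal d → ¬ LVal d → Normal (es c d)

record PlugLam {n} (a : Tm n) : Set where
  constructor plugLam
  field
    {j} : ℕ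
    L : SCtx n j
    t : Tm (suc j)
    a≡ : a ≡ plug L (lam t)

record PlugVal {n} (a : Tm n) : Set where
  constructor plugVal
  field
    {j} : ℕ
    {k} : Kind
    L : SCtx n j
    {h} : Tm j
    val : Val k h
    a≡ : a ≡ plug L h

LLam⇒PlugLam : ∀ {n} {a : Tm n} → LLam a → PlugLam a
LLam⇒PlugLam (ll-lam {t}) = plugLam hole t refl
LLam⇒PlugLam (ll-es {d = d} p) with LLam⇒PlugLam p
... | plugLam L t eq = plugLam (L [← d ]) t (cong (λ z → es z d) eq)

LVal⇒PlugVal : ∀ {n} {a : Tm n} → LVal a → PlugVal a
LVal⇒PlugVal (lv-var {i}) = plugVal hole (var i) refl
LVal⇒PlugVal (lv-lam {t}) = plugVal hole (lam t) refl
LVal⇒PlugVal (lv-es {d = d} p) with LVal⇒PlugVal p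
... | plugVal L vh eq = plugVal (L [← d ]) vh (cong (λ z → es z d) eq)

plug-LLam : ∀ {n j} (L : SCtx n j) t → LLam (plug L (lam t))
plug-LLam hole t = ll-lam
plug-LLam (L [← u ]) t = ll-es (plug-LLam L t)

plug-LVal : ∀ {n j k} (L : SCtx n j) {h} → Val k h → LVal (plug L h)
plug-LVal hole (var i) = lv-var
plug-LVal hole (lam t) = lv-lam
plug-LVal (L [← u ]) vh = lv-es (plug-LVal L vh)

vsubNormal⇒Normal : ∀ {n} (u : Tm n) → VsubNormal u → Normal u
vsubNormal⇒Normal (var i) nf = var
vsubNormal⇒Normal (lam u) nf = lam
vsubNormal⇒Normal (app a b) nf =
  app (vsubNormal⇒Normal a λ k _ → nf k _ ∘ appL) (vsubNormal⇒Normal b λ k _ → nf k _ ∘ appR) no-m-redex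
  where
  no-m-redex : ¬ LLam a
  no-m-redex ll with LLam⇒PlugLam ll
  ... | plugLam L t refl = nf m _ (root (rm L t b))
vsubNormal⇒Normal (es c d) nf =
  es (vsubNormal⇒Normal c λ k _ → nf k _ ∘ esL) (vsubNormal⇒Normal d λ k _ → nf k _ ∘ esR) no-e-redex
  where
  no-e-redex : ¬ LVal d
  no-e-redex lv with LVal⇒PlugVal lv
  ... | plugVal L vh refl = nf _ _ (e-root vh c L)

LLam-ren⁻¹ : ∀ {n n'} (ρ : Fin n → Fin n') (a : Tm n) → LLam (ren ρ a) → LLam a
LLam-ren⁻¹ ρ (lam a) ll-lam = ll-lam
LLam-ren⁻¹ ρ (es c d) (ll-es p) = ll-es (LLam-ren⁻¹ (ext ρ) c p)

LVal-ren⁻¹ : ∀ {n n'} (ρ : Fin n → Fin n') (a : Tm n) → LVal (ren ρ a) → LVal a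
LVal-ren⁻¹ ρ (var i) lv-var = lv-var
LVal-ren⁻¹ ρ (lam a) lv-lam = lv-lam
LVal-ren⁻¹ ρ (es c d) (lv-es p) = lv-es (LVal-ren⁻¹ (ext ρ) c p)

ren-Normal : ∀ {n n'} (ρ : Fin n → Fin n') {a : Tm n} → Normal a → Normal (ren ρ a)
ren-Normal ρ var = var
ren-Normal ρ lam = lam
ren-Normal ρ {app a b} (app p q nl) = app (ren-Normal ρ p) (ren-Normal ρ q) (nl ∘ LLam-ren⁻¹ ρ a)
ren-Normal ρ {es c d} (es p q nl) = es (ren-Normal (ext ρ) p) (ren-Normal ρ q) (nl ∘ LVal-ren⁻¹ ρ d)

app-step-cases : ∀ {n k} {a b t : Tm n} → Step k (app a b) t →
  (LLam a × k ≡ m) ⊎ (Σ (Tm n) λ a' → t ≡ app a' b × Step k a a')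
                  ⊎ (Σ (Tm n) λ b' → t ≡ app a b' × Step k b b')
app-step-cases (root (rm L t u)) = inj₁ (plug-LLam L t , refl)
app-step-cases (appL st) = inj₂ (inj₁ (_ , refl , st))
app-step-cases (appR st) = inj₂ (inj₂ (_ , refl , st))

-- TrReduct W a: W is tr a with some of the administrative redexes (A x)[x←B] of translated
-- applications fired.  FiredTrReduct W a b: W is such a reduct of tr (a b) whose outermost
-- administrative redex is fired, so W = L⟨A V⟩ with V a value.
data TrReduct : ∀ {n} → Tm n → Tm n → Set
data FiredTrReduct : ∀ {n} → Tm n → Tm n → Tm n → Set

data TrReduct where
  r-var : ∀ {n} {i : Fin n} → TrReduct (var i) (var i)
  r-lam : ∀ {n} {c : Tm (suc n)} → TrReduct (lam (tr c)) (lam c)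
  r-app : ∀ {n} {A B a b : Tm n} → TrReduct A a → TrReduct B b → TrReduct (es (app (wk A) (var zero)) B) (app a b)
  r-fire : ∀ {n} {W a b : Tm n} → FiredTrReduct W a b → TrReduct W (app a b)
  r-es : ∀ {n} {C c : Tm (suc n)} {D d : Tm n} → TrReduct C c → TrReduct D d → TrReduct (es C D) (es c d)

data FiredTrReduct where
  f-val : ∀ {n k} {A a V v : Tm n} → TrReduct A a → TrReduct V v → Val k V → FiredTrReduct (app A V) a v
  f-es : ∀ {n} {W c : Tm (suc n)} {a D d : Tm n} → FiredTrReduct W (wk a) c → TrReduct D d →
         FiredTrReduct (es W D) a (es c d)

tr-TrReduct : ∀ {n} (u : Tm n) → TrReduct (tr u) u
tr-TrReduct (var i) = r-var
tr-TrReduct (lam u) = r-lam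
tr-TrReduct (app a b) = r-app (tr-TrReduct a) (tr-TrReduct b)
tr-TrReduct (es c d) = r-es (tr-TrReduct c) (tr-TrReduct d)

FiredTrReduct-¬LLam : ∀ {n} {W a b : Tm n} → FiredTrReduct W a b → ¬ LLam W
FiredTrReduct-¬LLam (f-es f q) (ll-es p) = FiredTrReduct-¬LLam f p

TrReduct-LLam : ∀ {n} {W a : Tm n} → TrReduct W a → LLam W → LLam a
TrReduct-LLam r-lam ll-lam = ll-lam
TrReduct-LLam (r-fire f) p = ⊥-elim (FiredTrReduct-¬LLam f p)
TrReduct-LLam (r-es p q) (ll-es l) = ll-es (TrReduct-LLam p l)
TrReduct-LLam (r-app p q) (ll-es ())

FiredTrReduct-¬LVal : ∀ {n} {W a b : Tm n} → FiredTrReduct W a b → ¬ LVal W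
FiredTrReduct-¬LVal (f-es f q) (lv-es p) = FiredTrReduct-¬LVal f p

TrReduct-LVal : ∀ {n} {W a : Tm n} → TrReduct W a → LVal W → LVal a
TrReduct-LVal r-var lv-var = lv-var
TrReduct-LVal r-lam lv-lam = lv-lam
TrReduct-LVal (r-fire f) p = ⊥-elim (FiredTrReduct-¬LVal f p)
TrReduct-LVal (r-es p q) (lv-es l) = lv-es (TrReduct-LVal p l)
TrReduct-LVal (r-app p q) (lv-es ())

ren-TrReduct : ∀ {n n'} (ρ : Fin n → Fin n') {W a : Tm n} → TrReduct W a → TrReduct (ren ρ W) (ren ρ a)
ren-FiredTrReduct : ∀ {n n'} (ρ : Fin n → Fin n') {W a b : Tm n} → FiredTrReduct W a b →
  FiredTrReduct (ren ρ W) (ren ρ a) (ren ρ b)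
ren-TrReduct ρ r-var = r-var
ren-TrReduct ρ (r-lam {c = c}) = subst (λ z → TrReduct (lam z) (lam (ren (ext ρ) c))) (tr-ren (ext ρ) c) r-lam
ren-TrReduct ρ (r-app {A = A} {B} p q) =
  subst (λ z → TrReduct (es (app z (var zero)) (ren ρ B)) _) (wk-ren ρ A) (r-app (ren-TrReduct ρ p) (ren-TrReduct ρ q))
ren-TrReduct ρ (r-fire f) = r-fire (ren-FiredTrReduct ρ f)
ren-TrReduct ρ (r-es p q) = r-es (ren-TrReduct (ext ρ) p) (ren-TrReduct ρ q)
ren-FiredTrReduct ρ (f-val p q v) = f-val (ren-TrReduct ρ p) (ren-TrReduct ρ q) (ren-val ρ v)
ren-FiredTrReduct ρ (f-es {W = W} {c} {a} f q) =
  f-es (subst (λ z → FiredTrReduct (ren (ext ρ) W) z (ren (ext ρ) c)) (sym (wk-ren ρ a)) (ren-FiredTrReduct (ext ρ) f))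
    (ren-TrReduct ρ q)

TrReduct-m-normal : ∀ {n} {W a t : Tm n} → TrReduct W a → Normal a → ¬ Step m W t
FiredTrReduct-m-normal : ∀ {n} {W a b t : Tm n} → FiredTrReduct W a b → Normal a → ¬ LLam a → Normal b → ¬ Step m W t
TrReduct-m-normal r-var na st = var-irreducible st
TrReduct-m-normal r-lam na st = lam-irreducible st
TrReduct-m-normal (r-app {A = A} p q) (app na nb nll) (esL st) with app-step-cases st
... | inj₁ (ll , _) = nll (TrReduct-LLam p (LLam-ren⁻¹ suc A ll))
... | inj₂ (inj₁ (_ , _ , st')) = TrReduct-m-normal p na (proj₂ (proj₂ (ren-step⁻¹ suc A st' refl)))
... | inj₂ (inj₂ (_ , _ , st')) = var-irreducible st'
TrReduct-m-normal (r-app p q) (app na nb nll) (esR st) = TrReduct-m-normal q nb st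
TrReduct-m-normal (r-fire f) (app na nb nll) st = FiredTrReduct-m-normal f na nll nb st
TrReduct-m-normal (r-es p q) (es nc nd _) (esL st) = TrReduct-m-normal p nc st
TrReduct-m-normal (r-es p q) (es nc nd _) (esR st) = TrReduct-m-normal q nd st
FiredTrReduct-m-normal (f-val p q v) na nll nb st with app-step-cases st
... | inj₁ (ll , _) = nll (TrReduct-LLam p ll)
... | inj₂ (inj₁ (_ , _ , st')) = TrReduct-m-normal p na st'
... | inj₂ (inj₂ (_ , _ , st')) = val-irreducible v st'
FiredTrReduct-m-normal {a = a} (f-es f q) na nll (es nc nd _) (esL st) =
  FiredTrReduct-m-normal f (ren-Normal suc na) (nll ∘ LLam-ren⁻¹ suc a) nc st
FiredTrReduct-m-normal (f-es f q) na nll (es nc nd _) (esR st) = TrReduct-m-normal q nd st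

plug-val-≢-app : ∀ {n j k} (L : SCtx n j) {h : Tm j} → Val k h → ∀ {a b : Tm n} → app a b ≢ plug L h
plug-val-≢-app hole (var i) ()
plug-val-≢-app hole (lam t) ()
plug-val-≢-app (L [← u ]) vh ()

-- B = L⟨h⟩ forces the derivation of TrReduct B b to follow L and end in r-var or r-lam.
fire-administrative : ∀ {n j k} (L : SCtx n j) {h : Tm j} → Val k h → ∀ {B b : Tm n} → TrReduct B b → B ≡ plug L h →
  ∀ {A a} → TrReduct A a → FiredTrReduct (plug L (app (ren (under L) A) h)) a b
fire-administrative hole (var y) r-var refl {A} pA = f-val (subst (λ z → TrReduct z _) (sym (ren-id A)) pA) r-var (var y)
fire-administrative hole (lam _) r-lam refl {A} pA = f-val (subst (λ z → TrReduct z _) (sym (ren-id A)) pA) r-lam (lam _)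
fire-administrative hole (var _) (r-fire (f-val _ _ _)) ()
fire-administrative hole (var _) (r-fire (f-es _ _)) ()
fire-administrative hole (lam _) (r-fire (f-val _ _ _)) ()
fire-administrative hole (lam _) (r-fire (f-es _ _)) ()
fire-administrative (L [← w ]) vh (r-app p q) eq = ⊥-elim (plug-val-≢-app L vh (proj₁ (es-injective eq)))
fire-administrative (L [← w ]) vh (r-fire (f-es f q)) eq =
  ⊥-elim (FiredTrReduct-¬LVal f (subst LVal (sym (proj₁ (es-injective eq))) (plug-LVal L vh)))
fire-administrative (L [← w ]) {h} vh (r-es pC pD) eq {A} pA with es-injective eq
... | e₁ , refl = f-es (subst (λ z → FiredTrReduct (plug L (app z h)) _ _) (ren-ren (under L) suc A)
  (fire-administrative L vh pC e₁ (ren-TrReduct suc pA))) pD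

fire-TrReduct : ∀ {n j k} {h : Tm j} → Val k h → (L : SCtx n j) → ∀ {A a b} → TrReduct A a → TrReduct (plug L h) b →
  TrReduct (eContractum (app (wk A) (var zero)) L h) (app a b)
fire-TrReduct {h = h} vh L {A} {a} {b} pA pB =
  subst (λ z → TrReduct (plug L z) (app a b)) (sym contractum≡) (r-fire (fire-administrative L vh pB refl pA))
  where
  contractum≡ : subst0 (ren (ext (under L)) (app (wk A) (var zero))) h ≡ app (ren (under L) A) h
  contractum≡ = trans (subst0≡sub (ren (ext (under L)) (app (wk A) (var zero))) h)
    (cong (λ z → app z h) (sub-single-wk (under L) A h))

-- As a is normal, the only e-redexes of W are administrative ones.
TrReduct-e-step : ∀ {n k} {W a W' : Tm n} → TrReduct W a → Normal a → StepE k W W' → TrReduct W' a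
FiredTrReduct-e-step : ∀ {n k} {W a b W' : Tm n} → FiredTrReduct W a b → Normal a → ¬ LLam a → Normal b →
  StepE k W W' → FiredTrReduct W' a b
TrReduct-e-step r-var na (_ , st) = ⊥-elim (var-irreducible st)
TrReduct-e-step r-lam na (_ , st) = ⊥-elim (lam-irreducible st)
TrReduct-e-step (r-app p q) na (_ , root (reλ _ L v)) = fire-TrReduct (lam v) L p q
TrReduct-e-step (r-app p q) na (_ , root (revar _ L y)) = fire-TrReduct (var y) L p q
TrReduct-e-step (r-app {A = A} p q) (app na nb nll) (isE , esL st) with app-step-cases st
... | inj₁ (_ , refl) = ⊥-elim isE
... | inj₂ (inj₁ (_ , refl , st')) with ren-step⁻¹ suc A st' refl
... | _ , refl , st'' = r-app (TrReduct-e-step p na (isE , st'')) q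
TrReduct-e-step (r-app p q) na (_ , esL st) | inj₂ (inj₂ (_ , _ , st')) = ⊥-elim (var-irreducible st')
TrReduct-e-step (r-app p q) (app na nb nll) (isE , esR st) = r-app p (TrReduct-e-step q nb (isE , st))
TrReduct-e-step (r-fire f) (app na nb nll) st = r-fire (FiredTrReduct-e-step f na nll nb st)
TrReduct-e-step (r-es p q) (es nc nd nlv) (isE , esL st) = r-es (TrReduct-e-step p nc (isE , st)) q
TrReduct-e-step (r-es p q) (es nc nd nlv) (isE , esR st) = r-es p (TrReduct-e-step q nd (isE , st))
TrReduct-e-step (r-es p q) (es nc nd nlv) (_ , root (reλ _ L v)) = ⊥-elim (nlv (TrReduct-LVal q (plug-LVal L (lam v))))
TrReduct-e-step (r-es p q) (es nc nd nlv) (_ , root (revar _ L y)) = ⊥-elim (nlv (TrReduct-LVal q (plug-LVal L (var y))))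
FiredTrReduct-e-step (f-val p q v) na nll nb (isE , st) with app-step-cases st
... | inj₁ (_ , refl) = ⊥-elim isE
... | inj₂ (inj₁ (_ , refl , st')) = f-val (TrReduct-e-step p na (isE , st')) q v
... | inj₂ (inj₂ (_ , _ , st')) = ⊥-elim (val-irreducible v st')
FiredTrReduct-e-step {a = a} (f-es f q) na nll (es nc nd nlv) (isE , esL st) =
  f-es (FiredTrReduct-e-step f (ren-Normal suc na) (nll ∘ LLam-ren⁻¹ suc a) nc (isE , st)) q
FiredTrReduct-e-step (f-es f q) na nll (es nc nd nlv) (isE , esR st) = f-es f (TrReduct-e-step q nd (isE , st))
FiredTrReduct-e-step (f-es f q) na nll (es nc nd nlv) (_ , root (reλ _ L v)) =
  ⊥-elim (nlv (TrReduct-LVal q (plug-LVal L (lam v))))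
FiredTrReduct-e-step (f-es f q) na nll (es nc nd nlv) (_ , root (revar _ L y)) =
  ⊥-elim (nlv (TrReduct-LVal q (plug-LVal L (var y))))

TrReduct-e-steps : ∀ {n} {W a W' : Tm n} → TrReduct W a → Normal a → Deriv StepE W W' → TrReduct W' a
TrReduct-e-steps p na ε = p
TrReduct-e-steps p na (st ◅ d) = TrReduct-e-steps (TrReduct-e-step p na st) na d

≈tr-normal⇒MNormal : ∀ {n} {s u : Tm n} → VsubNormal u → s ≈ tr u → MNormal s
≈tr-normal⇒MNormal {u = u} nf p t st =
  TrReduct-m-normal (tr-TrReduct u) (vsubNormal⇒Normal u nf) (proj₁ (proj₂ (≈-simulation p st)))

≈tr-normal⇒e-normal-forms : ∀ {n} {s u : Tm n} → VsubNormal u → s ≈ tr u →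
  ∀ nf → Deriv StepE s nf → ENormal nf → VsubKNormal nf
≈tr-normal⇒e-normal-forms {u = u} normal p nf d e-normal with ≈-simulationᵉ p d
... | w , d' , nf≈w = λ k t (_ , _ , st) → w-normal k (proj₁ (proj₂ (≈-simulation nf≈w st)))
  where
  w-normal : ∀ k {t} → ¬ Step k w t
  u-normal : Normal u
  u-normal = vsubNormal⇒Normal u normal
  w-normal m = TrReduct-m-normal (TrReduct-e-steps (tr-TrReduct u) u-normal d') u-normal
  w-normal eλ st = e-normal eλ _ (tt , proj₁ (proj₂ (≈-simulation (≈-sym nf≈w) st)))
  w-normal evar st = e-normal evar _ (tt , proj₁ (proj₂ (≈-simulation (≈-sym nf≈w) st)))

theorem3 : ∀ {n} (t u : Tm n) (d : Deriv Step t u) →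
    Σ (Tm n) λ s → IsKernel s × Σ (Deriv StepK (tr t) s) λ e →
      (s ≡s tr u)
      × (count m e ≡ count m d × count eλ e ≡ count eλ d × count evar e ≡ count evar d + count m d)
      × (VsubNormal u → MNormal s × (∀ nf → Deriv StepE s nf → ENormal nf → VsubKNormal nf))
theorem3 t u d with tr-simulation* d ε
... | s , D , s≈ , counts with kernel-deriv (tr-kernel t) D
... | e , e-counts =
  s , deriv-kernel (tr-kernel t) D , e , ≈⇒≡s s≈ ,
  (same m (simCount-m d) , same eλ (simCount-eλ d) , same evar (simCount-evar d)) ,
  λ normal → ≈tr-normal⇒MNormal normal s≈ , ≈tr-normal⇒e-normal-forms normal s≈
  where
  same : ∀ {x} k → simCount k d ≡ x → count k e ≡ x
  same k eq = trans (e-counts k) (trans (counts k) eq)
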